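{- Let $L$ be a finite set and let $\mathcal{X}\subseteq L\times L$ be an irreflexive relation. Then $\mathcal{X}$ is valid if and only if $\mathcal{X}$ is a Fitch relation.
   Context: A rooted tree $T=(V,E)$ with leaf set $L$ has a distinguished root $\rho_T$, which is regarded as an inner vertex. $T$ is phylogenetic if $\deg(\rho_T)\ge 2$ and every other inner vertex has degree at least $3$. Edges are written $(u,v)$ with $u$ the parent of $v$. An edge-labeled tree is a pair $(T,\lambda)$ with $\lambda:E\to\{0,1\}$; edges with label $1$ (resp. $0$) are called 1-edges (resp. 0-edges). For an edge-labeled phylogenetic tree $(T,\lambda)$ with leaf set $L$, define $\mathcal{X}_{(T,\lambda)}\subseteq L\times L$ by: for distinct $x,y\in L$, $(x,y)\in\mathcal{X}_{(T,\lambda)}$ if and only if the unique path from the least common ancestor $\operatorname{lca}_T(x,y)$ to $y$ contains at least one 1-edge. $(T,\lambda)$ explains an irreflexive relation $\mathcal{X}$ on $L$ if $\mathcal{X}=\mathcal{X}_{(T,\lambda)}$. An irreflexive relation $\mathcal{X}$ on $L$ is valid if some edge-labeled phylogenetic tree with leaf set $L$ explains it. An irreflexive relation $\mathcal{X}$ on $L$ is a Fitch relation if for every three distinct elements $a,b,c\in L$ the restriction $\mathcal{X}\cap(\{a,b,c\}\times\{a,b,c\})$ is valid as a relation on $\{a,b,c\}$ (i.e. all induced subgraphs on three vertices, "triangles", are valid). -}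

module Defs where

open import Data.Nat using (ℕ; suc; _≥_)
open import Data.Fin using (Fin; zero; suc)
open import Data.Fin.Properties using (_≟_)
open import Data.Bool using (Bool; true; false; _∨_; if_then_else_)
open import Data.List using (List; []; _∷_; _++_; length; allFin)
open import Data.List.Relation.Unary.All using (All)
open import Data.List.Relation.Binary.Permutation.Propositional using (_↭_)
open import Data.Product using (Σ; _×_; _,_; proj₂)
open import Relation.Binary.PropositionalEquality using (_≡_; _≢_)
open import Relation.Nullary.Decidable using (⌊_⌋)

-- Binary relations on a finite set L = Fin n, given as Boolean matrices
-- (X x y ≡ true  means  (x , y) ∈ X).

Rel₂ : ℕ → Set
Rel₂ n = Fin n → Fin n → Bool

Irreflexive : ∀ {n} → Rel₂ n → Set
Irreflexive X = ∀ x → X x x ≡ false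

-- Rooted trees whose leaves are labelled by elements of Fin n, and whose
-- edges carry a label in {0,1} (false = 0-edge, true = 1-edge).
-- A node lists its children, each together with the label λ(u,v) of the
-- edge from the node u to that child v.

data Tree (n : ℕ) : Set where
  leaf : Fin n → Tree n
  node : List (Bool × Tree n) → Tree n

mutual
  leaves : ∀ {n} → Tree n → List (Fin n)
  leaves (leaf x) = x ∷ []
  leaves (node cs) = leavesL cs

  leavesL : ∀ {n} → List (Bool × Tree n) → List (Fin n)
  leavesL [] = []
  leavesL ((_ , c) ∷ cs) = leaves c ++ leavesL cs

mutual
  -- phylogenetic: every inner vertex has at least two children
  -- (root: degree ≥ 2; other inner vertices: degree ≥ 3)
  Phylogenetic : ∀ {n} → Tree n → Set
  Phylogenetic (leaf _) = Data.Unit.⊤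
    where import Data.Unit
  Phylogenetic (node cs) = (length cs ≥ 2) × PhyloL cs

  PhyloL : ∀ {n} → List (Bool × Tree n) → Set
  PhyloL [] = Data.Unit.⊤
    where import Data.Unit
  PhyloL ((_ , c) ∷ cs) = Phylogenetic c × PhyloL cs

HasLeafSet : ∀ {n} → Tree n → Set
HasLeafSet {n} T = leaves T ↭ allFin n

mutual
  contains : ∀ {n} → Tree n → Fin n → Bool
  contains (leaf z) y = ⌊ z ≟ y ⌋
  contains (node cs) y = containsL cs y

  containsL : ∀ {n} → List (Bool × Tree n) → Fin n → Bool
  containsL [] y = false
  containsL ((_ , c) ∷ cs) y = contains c y ∨ containsL cs y

mutual
  oneOnPath : ∀ {n} → Tree n → Fin n → Bool
  oneOnPath (leaf _) y = false
  oneOnPath (node cs) y = oneOnPathL cs y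

  oneOnPathL : ∀ {n} → List (Bool × Tree n) → Fin n → Bool
  oneOnPathL [] y = false
  oneOnPathL ((b , c) ∷ cs) y =
    if contains c y then b ∨ oneOnPath c y else oneOnPathL cs y

mutual
  -- X_(T,λ)(x,y) for distinct leaves x,y: descend while x and y lie in the
  -- same child subtree; at lca(x,y) take the edge towards y and check
  -- whether the path lca(x,y) ⇝ y contains a 1-edge.
  fitchRel : ∀ {n} → Tree n → Fin n → Fin n → Bool
  fitchRel (leaf _) x y = false
  fitchRel (node cs) x y = fitchRelL cs x y

  fitchRelL : ∀ {n} → List (Bool × Tree n) → Fin n → Fin n → Bool
  fitchRelL [] x y = false
  fitchRelL ((b , c) ∷ cs) x y =
    if contains c y
      then (if contains c x then fitchRel c x y else b ∨ oneOnPath c y)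
      else fitchRelL cs x y

Explains : ∀ {n} → Tree n → Rel₂ n → Set
Explains T X = ∀ x y → x ≢ y → X x y ≡ fitchRel T x y

Valid : ∀ {n} → Rel₂ n → Set
Valid {n} X = Σ (Tree n) λ T → Phylogenetic T × HasLeafSet T × Explains T X

triple : ∀ {n} → Fin n → Fin n → Fin n → Fin 3 → Fin n
triple a b c zero = a
triple a b c (suc zero) = b
triple a b c (suc (suc zero)) = c

restrict3 : ∀ {n} → Rel₂ n → Fin n → Fin n → Fin n → Rel₂ 3
restrict3 X a b c i j = X (triple a b c i) (triple a b c j)

Fitch : ∀ {n} → Rel₂ n → Set
Fitch {n} X = ∀ (a b c : Fin n) → a ≢ b → a ≢ c → b ≢ c → Valid (restrict3 X a b c)

module Submission where

-- Write "x ⊑ y" for X x y ≡ false: in a tree explaining X it says that the path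
-- from lca(x,y) down to y carries only 0-edges.  Both properties of the theorem
-- are shown equivalent to two axioms on ⊑:
--   (zero-transitivity)  x ⊑ y → y ⊑ z → x ⊑ z,
--   (zero-comparability) x ⊑ y → x ⊑ z → y ⊑ z or z ⊑ y.
-- Necessity: both axioms hold for the relation of every edge-labelled tree with
-- distinct leaves, by induction on the tree.  Sufficiency: from the axioms a tree
-- of binary nodes is built by mutual recursion on "planted" trees (a tree plus the
-- label of the edge above it, with the profile X x · of an outside leaf x).  The
-- top level picks a ⊑-maximal element m, puts m's down-set {x | x ⊑ m} below a
-- 1-edge and recurses on the remaining elements; the down-set is built by hanging
-- m as a leaf next to the tree of the others.  The two generic operations are
-- joining two planted trees under a fork and relabelling the edge above.
-- Locality: both axioms speak about three elements at a time and are inherited by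
-- restrictions, so they hold for X exactly when they hold for every triangle; a
-- triangle satisfies them exactly when it is valid, by the equivalence for n = 3.

open import Defs
open import Data.Nat using (ℕ; zero; suc; _≤_; _<_; z≤n; s≤s)
open import Data.Nat.Properties using (≤-refl; ≤-trans; ≤-reflexive; ≤-<-trans)
open import Data.Fin using (Fin; zero; suc)
open import Data.Fin.Properties using (_≟_)
open import Data.Bool using (Bool; true; false; _∨_; if_then_else_)
open import Data.Bool.Properties using (∨-conicalˡ; ∨-conicalʳ; ¬-not) renaming (_≟_ to _≟ᵇ_)
open import Data.List using (List; []; _∷_; _++_; [_]; length; filter; allFin)
open import Data.List.Properties using (partition-defn; length-filter)
import Data.List.Relation.Unary.All as All
import Data.List.Relation.Unary.All.Properties as All
open import Data.List.Relation.Unary.Any using (here; there; any?)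
open import Data.List.Relation.Unary.Unique.Propositional using (Unique; []; _∷_)
open import Data.List.Relation.Unary.Unique.Propositional.Properties
  using (allFin⁺; filter⁺; Unique[x∷xs]⇒x∉xs)
open import Data.List.Relation.Binary.Disjoint.Propositional using (Disjoint)
open import Data.List.Membership.Propositional using (_∈_; _∉_; find; lose)
open import Data.List.Membership.Propositional.Properties
  using (∈-∃++; ∈-++⁺ˡ; ∈-++⁺ʳ; ∈-++⁻; ∈-filter⁻; ∈-allFin)
open import Data.List.Relation.Binary.Permutation.Propositional
  using (_↭_; ↭-refl; ↭-prep; ↭-sym; ↭-trans; ↭⇒↭ₛ; ↭ₛ⇒↭)
open import Data.List.Relation.Binary.Permutation.Propositional.Properties
  using (shift; ++⁺; ++-identityʳ; ∈-resp-↭; ↭-length)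
import Data.List.Relation.Binary.Permutation.Setoid.Properties as Permutationₛ
open import Data.Product using (∃; _×_; _,_; proj₁; proj₂)
open import Data.Sum using (_⊎_; inj₁; inj₂) renaming (map to map⊎)
open import Data.Empty using (⊥-elim)
open import Data.Unit using (tt)
open import Function.Base using (case_of_)
open import Function.Bundles using (_⇔_; mk⇔)
open import Relation.Binary.Definitions using (Transitive) renaming (Decidable to Decidable₂)
open import Relation.Binary.PropositionalEquality using (_≡_; _≢_; refl; sym; trans; setoid)
open import Relation.Nullary using (Dec; yes; no)
open import Relation.Unary using (Pred; Decidable)
open import Relation.Unary.Properties using (∁?)

module _ {A : Set} where

  unique-++⁻ : ∀ (xs : List A) {ys} → Unique (xs ++ ys) →
               Unique xs × Unique ys × Disjoint xs ys
  unique-++⁻ [] u = [] , u , λ ()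
  unique-++⁻ (x ∷ xs) (x∉ ∷ u) with unique-++⁻ xs u
  ... | uxs , uys , disjoint = All.++⁻ˡ xs x∉ ∷ uxs , uys , sharesNothing
    where
    sharesNothing : Disjoint (x ∷ xs) _
    sharesNothing (here refl , v∈ys) = All.lookup (All.++⁻ʳ xs x∉) v∈ys refl
    sharesNothing (there v∈xs , v∈ys) = disjoint (v∈xs , v∈ys)

  unique-resp-↭ : ∀ {xs ys : List A} → xs ↭ ys → Unique xs → Unique ys
  unique-resp-↭ p = Permutationₛ.Unique-resp-↭ (setoid A) (↭⇒↭ₛ p)

  extract : ∀ {m : A} {xs} → m ∈ xs → ∃ λ ys → xs ↭ m ∷ ys
  extract {m} m∈xs with ∈-∃++ m∈xs
  ... | ys , zs , refl = ys ++ zs , shift m ys zs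

  split : ∀ {p} {P : Pred A p} (P? : Decidable P) (xs : List A) →
          xs ↭ filter P? xs ++ filter (∁? P?) xs
  split P? xs with ↭ₛ⇒↭ (Permutationₛ.partition-↭ (setoid A) P? xs)
  ... | p rewrite partition-defn P? xs = p

  maximal : ∀ {R : A → A → Set} → Transitive R → Decidable₂ R → ∀ s ss →
            ∃ λ m → m ∈ s ∷ ss × (∀ {z} → z ∈ s ∷ ss → R m z → R z m)
  maximal _ _ s [] = s , here refl , λ { (here refl) r → r }
  maximal {R} R-trans R? s (t ∷ ts) with maximal R-trans R? t ts
  ... | c , c∈ , cMax = compare (R? c s) (R? s c)
    where
    stillMax : (R c s → R s c) → ∀ {z} → z ∈ s ∷ t ∷ ts → R c z → R z c
    stillMax atS (here refl) = atS
    stillMax _ (there z∈) = cMax z∈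

    compare : Dec (R c s) → Dec (R s c) → ∃ λ m → m ∈ s ∷ t ∷ ts × (∀ {z} → z ∈ s ∷ t ∷ ts → R m z → R z m)
    compare (yes c≤s) (no _) = s , here refl , sMax
      where
      sMax : ∀ {z} → z ∈ s ∷ t ∷ ts → R s z → R z s
      sMax (here refl) r = r
      sMax (there z∈) s≤z = R-trans (cMax z∈ (R-trans c≤s s≤z)) c≤s
    compare (yes _) (yes s≤c) = c , there c∈ , stillMax (λ _ → s≤c)
    compare (no c≰s) _ = c , there c∈ , stillMax (λ c≤s → ⊥-elim (c≰s c≤s))

module _ {n : ℕ} where

  mutual
    contains⇒∈ : ∀ (T : Tree n) {v} → contains T v ≡ true → v ∈ leaves T
    contains⇒∈ (leaf z) {v} h with z ≟ v
    contains⇒∈ (leaf z) h | yes refl = here refl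
    contains⇒∈ (leaf z) () | no _
    contains⇒∈ (node cs) h = containsL⇒∈ cs h

    containsL⇒∈ : ∀ (cs : List (Bool × Tree n)) {v} → containsL cs v ≡ true → v ∈ leavesL cs
    containsL⇒∈ [] ()
    containsL⇒∈ ((_ , c) ∷ cs) {v} h with contains c v in v∈c
    ... | true = ∈-++⁺ˡ (contains⇒∈ c v∈c)
    ... | false = ∈-++⁺ʳ (leaves c) (containsL⇒∈ cs h)

  mutual
    ∈⇒contains : ∀ (T : Tree n) {v} → v ∈ leaves T → contains T v ≡ true
    ∈⇒contains (leaf z) (here refl) with z ≟ z
    ... | yes _ = refl
    ... | no z≢z = ⊥-elim (z≢z refl)
    ∈⇒contains (node cs) v∈ = ∈⇒containsL cs v∈

    ∈⇒containsL : ∀ (cs : List (Bool × Tree n)) {v} → v ∈ leavesL cs → containsL cs v ≡ true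
    ∈⇒containsL ((_ , c) ∷ cs) {v} v∈ with ∈-++⁻ (leaves c) v∈
    ... | inj₁ v∈c rewrite ∈⇒contains c v∈c = refl
    ... | inj₂ v∈cs rewrite ∈⇒containsL cs v∈cs with contains c v
    ...   | true = refl
    ...   | false = refl

  inside : ∀ (T : Tree n) {S v} → leaves T ↭ S → v ∈ S → contains T v ≡ true
  inside T p v∈S = ∈⇒contains T (∈-resp-↭ (↭-sym p) v∈S)

  outside : ∀ (T : Tree n) {S v} → leaves T ↭ S → v ∉ S → contains T v ≡ false
  outside T {v = v} p v∉S with contains T v in v∈T
  ... | false = refl
  ... | true = ⊥-elim (v∉S (∈-resp-↭ p (contains⇒∈ T v∈T)))

  siblings-disjoint : ∀ (c : Tree n) (cs : List (Bool × Tree n)) → Unique (leaves c ++ leavesL cs) →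
                      ∀ {v} → contains c v ≡ true → containsL cs v ≡ false
  siblings-disjoint c cs u {v} v∈c with containsL cs v in v∈cs
  ... | false = refl
  ... | true with unique-++⁻ (leaves c) u
  ...   | _ , _ , disjoint = ⊥-elim (disjoint (contains⇒∈ c v∈c , containsL⇒∈ cs v∈cs))

  mutual
    fitchRel-diagonal : ∀ (T : Tree n) x → fitchRel T x x ≡ false
    fitchRel-diagonal (leaf _) x = refl
    fitchRel-diagonal (node cs) x = fitchRelL-diagonal cs x

    fitchRelL-diagonal : ∀ (cs : List (Bool × Tree n)) x → fitchRelL cs x x ≡ false
    fitchRelL-diagonal [] x = refl
    fitchRelL-diagonal ((_ , c) ∷ cs) x with contains c x
    ... | true = fitchRel-diagonal c x
    ... | false = fitchRelL-diagonal cs x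

  -- Seen from a leaf x outside T, the root of T is lca(x,y), so X_T(x,y) only
  -- records whether the root-to-y path carries a 1-edge.
  mutual
    fitchRel-outsider : ∀ (T : Tree n) {x} y → contains T x ≡ false → fitchRel T x y ≡ oneOnPath T y
    fitchRel-outsider (leaf _) y x∉ = refl
    fitchRel-outsider (node cs) y x∉ = fitchRelL-outsider cs y x∉

    fitchRelL-outsider : ∀ (cs : List (Bool × Tree n)) {x} y → containsL cs x ≡ false →
                         fitchRelL cs x y ≡ oneOnPathL cs y
    fitchRelL-outsider [] y x∉ = refl
    fitchRelL-outsider ((b , c) ∷ cs) {x} y x∉ with contains c y
    ... | true rewrite ∨-conicalˡ (contains c x) _ x∉ = refl
    ... | false = fitchRelL-outsider cs y (∨-conicalʳ (contains c x) _ x∉)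

  outsiders-agree : ∀ (c : Tree n) (cs : List (Bool × Tree n)) → Unique (leaves c ++ leavesL cs) →
    ∀ {v v' w} → contains c v ≡ true → contains c v' ≡ true → fitchRelL cs v w ≡ fitchRelL cs v' w
  outsiders-agree c cs u {w = w} v∈c v'∈c =
    trans (fitchRelL-outsider cs w (siblings-disjoint c cs u v∈c))
          (sym (fitchRelL-outsider cs w (siblings-disjoint c cs u v'∈c)))

  -- A path free of 1-edges from the root to y is free of them below any lca(x,y).
  mutual
    fitchRel-zeroPath : ∀ (T : Tree n) x {y} → oneOnPath T y ≡ false → fitchRel T x y ≡ false
    fitchRel-zeroPath (leaf _) x h = refl
    fitchRel-zeroPath (node cs) x h = fitchRelL-zeroPath cs x h

    fitchRelL-zeroPath : ∀ (cs : List (Bool × Tree n)) x {y} → oneOnPathL cs y ≡ false →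
                         fitchRelL cs x y ≡ false
    fitchRelL-zeroPath [] x h = refl
    fitchRelL-zeroPath ((b , c) ∷ cs) x {y} h with contains c y
    ... | false = fitchRelL-zeroPath cs x h
    ... | true with contains c x
    ...   | true = fitchRel-zeroPath c x (∨-conicalʳ b _ h)
    ...   | false = h

  -- Zero-transitivity as seen from a leaf outside T (the first argument being the root).
  mutual
    oneOnPath-zeroStep : ∀ (T : Tree n) → Unique (leaves T) → ∀ {y' y} →
      oneOnPath T y' ≡ false → fitchRel T y' y ≡ false → oneOnPath T y ≡ false
    oneOnPath-zeroStep (leaf _) u h₁ h₂ = refl
    oneOnPath-zeroStep (node cs) u h₁ h₂ = oneOnPathL-zeroStep cs u h₁ h₂

    oneOnPathL-zeroStep : ∀ (cs : List (Bool × Tree n)) → Unique (leavesL cs) → ∀ {y' y} →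
      oneOnPathL cs y' ≡ false → fitchRelL cs y' y ≡ false → oneOnPathL cs y ≡ false
    oneOnPathL-zeroStep [] u h₁ h₂ = refl
    oneOnPathL-zeroStep ((b , c) ∷ cs) u {y'} {y} h₁ h₂
      with unique-++⁻ (leaves c) u | contains c y | contains c y' in y'∈c
    ... | uc , _ , _ | true | true rewrite ∨-conicalˡ b _ h₁ =
      oneOnPath-zeroStep c uc (∨-conicalʳ b _ h₁) h₂
    ... | _ | true | false = h₂
    ... | _ | false | true = trans (sym (fitchRelL-outsider cs y (siblings-disjoint c cs u y'∈c))) h₂
    ... | _ , ucs , _ | false | false = oneOnPathL-zeroStep cs ucs h₁ h₂

  mutual
    fitchRel-zeroTransitive : ∀ (T : Tree n) → Unique (leaves T) → ∀ {x y' y} →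
      fitchRel T x y' ≡ false → fitchRel T y' y ≡ false → fitchRel T x y ≡ false
    fitchRel-zeroTransitive (leaf _) u h₁ h₂ = refl
    fitchRel-zeroTransitive (node cs) u h₁ h₂ = fitchRelL-zeroTransitive cs u h₁ h₂

    fitchRelL-zeroTransitive : ∀ (cs : List (Bool × Tree n)) → Unique (leavesL cs) → ∀ {x y' y} →
      fitchRelL cs x y' ≡ false → fitchRelL cs y' y ≡ false → fitchRelL cs x y ≡ false
    fitchRelL-zeroTransitive [] u h₁ h₂ = refl
    fitchRelL-zeroTransitive ((b , c) ∷ cs) u {x} {y'} {y} h₁ h₂
      with unique-++⁻ (leaves c) u | contains c y | contains c x | contains c y' in y'∈c
    ... | _ , ucs , _ | false | _ | false = fitchRelL-zeroTransitive cs ucs h₁ h₂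
    ... | _ | false | _ | true =
      fitchRelL-zeroPath cs x (trans (sym (fitchRelL-outsider cs y (siblings-disjoint c cs u y'∈c))) h₂)
    ... | uc , _ , _ | true | true | true = fitchRel-zeroTransitive c uc h₁ h₂
    ... | _ | true | true | false = fitchRel-zeroPath c x (∨-conicalʳ b _ h₂)
    ... | uc , _ , _ | true | false | true rewrite ∨-conicalˡ b _ h₁ =
      oneOnPath-zeroStep c uc (∨-conicalʳ b _ h₁) h₂
    ... | _ | true | false | false = h₂

  mutual
    fitchRel-zeroComparable : ∀ (T : Tree n) → Unique (leaves T) → ∀ {x y y'} →
      fitchRel T x y ≡ false → fitchRel T x y' ≡ false →
      fitchRel T y y' ≡ false ⊎ fitchRel T y' y ≡ false
    fitchRel-zeroComparable (leaf _) u h₁ h₂ = inj₁ refl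
    fitchRel-zeroComparable (node cs) u h₁ h₂ = fitchRelL-zeroComparable cs u h₁ h₂

    fitchRelL-zeroComparable : ∀ (cs : List (Bool × Tree n)) → Unique (leavesL cs) → ∀ {x y y'} →
      fitchRelL cs x y ≡ false → fitchRelL cs x y' ≡ false →
      fitchRelL cs y y' ≡ false ⊎ fitchRelL cs y' y ≡ false
    fitchRelL-zeroComparable [] u h₁ h₂ = inj₁ refl
    fitchRelL-zeroComparable ((b , c) ∷ cs) u {x} {y} {y'} h₁ h₂
      with unique-++⁻ (leaves c) u | contains c y in y∈c | contains c y' in y'∈c | contains c x in x∈c
    ... | uc , _ , _ | true | true | true = fitchRel-zeroComparable c uc h₁ h₂
    ... | _ | true | true | false = inj₂ (fitchRel-zeroPath c y' (∨-conicalʳ b _ h₁))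
    ... | _ | true | false | true = inj₁ (trans (outsiders-agree c cs u y∈c x∈c) h₂)
    ... | _ | true | false | false = inj₂ h₁
    ... | _ | false | true | true = inj₂ (trans (outsiders-agree c cs u y'∈c x∈c) h₁)
    ... | _ | false | true | false = inj₁ h₂
    ... | _ , ucs , _ | false | false | _ = fitchRelL-zeroComparable cs ucs h₁ h₂

  -- The binary node, the only kind of inner vertex the construction uses, and how
  -- its relation decomposes according to the child holding y.
  fork : Bool → Tree n → Bool → Tree n → Tree n
  fork b₁ T₁ b₂ T₂ = node ((b₁ , T₁) ∷ (b₂ , T₂) ∷ [])

  module Fork (b₁ : Bool) (T₁ : Tree n) (b₂ : Bool) (T₂ : Tree n) {y : Fin n} where

    fork-pathˡ : contains T₁ y ≡ true → oneOnPath (fork b₁ T₁ b₂ T₂) y ≡ b₁ ∨ oneOnPath T₁ y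
    fork-pathˡ y∈T₁ rewrite y∈T₁ = refl

    fork-pathʳ : contains T₁ y ≡ false → contains T₂ y ≡ true →
                 oneOnPath (fork b₁ T₁ b₂ T₂) y ≡ b₂ ∨ oneOnPath T₂ y
    fork-pathʳ y∉T₁ y∈T₂ rewrite y∉T₁ | y∈T₂ = refl

    fork-relˡ : ∀ x → contains T₁ y ≡ true → fitchRel (fork b₁ T₁ b₂ T₂) x y ≡
                (if contains T₁ x then fitchRel T₁ x y else b₁ ∨ oneOnPath T₁ y)
    fork-relˡ x y∈T₁ rewrite y∈T₁ = refl

    fork-relʳ : ∀ x → contains T₁ y ≡ false → contains T₂ y ≡ true → fitchRel (fork b₁ T₁ b₂ T₂) x y ≡
                (if contains T₂ x then fitchRel T₂ x y else b₂ ∨ oneOnPath T₂ y)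
    fork-relʳ x y∉T₁ y∈T₂ rewrite y∉T₁ | y∈T₂ = refl

module _ {n : ℕ} where

  ZeroTransitive : Rel₂ n → Set
  ZeroTransitive X = ∀ {x y z} → X x y ≡ false → X y z ≡ false → X x z ≡ false

  ZeroComparable : Rel₂ n → Set
  ZeroComparable X = ∀ {x y z} → X x y ≡ false → X x z ≡ false → X y z ≡ false ⊎ X z y ≡ false

  record FitchAxioms (X : Rel₂ n) : Set where
    field
      zeroTransitive : ZeroTransitive X
      zeroComparable : ZeroComparable X

  valid⇒axioms : ∀ {X : Rel₂ n} → Irreflexive X → Valid X → FitchAxioms X
  valid⇒axioms {X} irreflexive (T , _ , leafSet , explains) = record
    { zeroTransitive = λ h₁ h₂ → fromTree (fitchRel-zeroTransitive T distinct (toTree h₁) (toTree h₂))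
    ; zeroComparable = λ h₁ h₂ → map⊎ fromTree fromTree
                                   (fitchRel-zeroComparable T distinct (toTree h₁) (toTree h₂))
    }
    where
    distinct : Unique (leaves T)
    distinct = unique-resp-↭ (↭-sym leafSet) (allFin⁺ n)

    -- Off the diagonal by assumption, on it by irreflexivity, X agrees with the tree.
    agree : ∀ x y → X x y ≡ fitchRel T x y
    agree x y with x ≟ y
    ... | yes refl = trans (irreflexive x) (sym (fitchRel-diagonal T x))
    ... | no x≢y = explains x y x≢y

    toTree : ∀ {x y} → X x y ≡ false → fitchRel T x y ≡ false
    toTree {x} {y} = trans (sym (agree x y))

    fromTree : ∀ {x y} → fitchRel T x y ≡ false → X x y ≡ false
    fromTree {x} {y} = trans (agree x y)

-- A planted tree for S with profile f: a phylogenetic tree with leaf set S that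
-- explains X on S, together with a label for the edge above it, such that a leaf
-- x hanging off that edge from outside would satisfy X x y ≡ f y for y ∈ S.
module Planting {N : ℕ} (X : Rel₂ N) (irreflexive : Irreflexive X) where

  record Planted (S : List (Fin N)) (f : Fin N → Bool) : Set where
    field
      label        : Bool
      tree         : Tree N
      phylogenetic : Phylogenetic tree
      leafSet      : leaves tree ↭ S
      explains     : ∀ {x y} → x ∈ S → y ∈ S → fitchRel tree x y ≡ X x y
      profile      : ∀ {y} → y ∈ S → label ∨ oneOnPath tree y ≡ f y

  open Planted

  holds : ∀ {S f} (P : Planted S f) {y} → y ∈ S → contains (tree P) y ≡ true
  holds P = inside (tree P) (leafSet P)

  lacks : ∀ {S f} (P : Planted S f) {y} → y ∉ S → contains (tree P) y ≡ false
  lacks P = outside (tree P) (leafSet P)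

  sprout : ∀ m → Planted [ m ] (X m)
  sprout m = record
    { label = false ; tree = leaf m ; phylogenetic = tt ; leafSet = ↭-refl
    ; explains = λ { (here refl) (here refl) → sym (irreflexive m) }
    ; profile = λ { (here refl) → sym (irreflexive m) }
    }

  reorder : ∀ {S S' f} → Planted S f → S ↭ S' → Planted S' f
  reorder P p = record
    { label = label P ; tree = tree P ; phylogenetic = phylogenetic P
    ; leafSet = ↭-trans (leafSet P) p
    ; explains = λ x∈ y∈ → explains P (∈-resp-↭ (↭-sym p) x∈) (∈-resp-↭ (↭-sym p) y∈)
    ; profile = λ y∈ → profile P (∈-resp-↭ (↭-sym p) y∈)
    }

  relabel : ∀ {S f g} → Planted S f → (∀ {y} → y ∈ S → f y ≡ g y) → Planted S g
  relabel P f≗g = record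
    { label = label P ; tree = tree P ; phylogenetic = phylogenetic P ; leafSet = leafSet P
    ; explains = explains P ; profile = λ y∈ → trans (profile P y∈) (f≗g y∈)
    }

  raise : ∀ {S f} → Planted S f → Planted S (λ _ → true)
  raise P = record
    { label = true ; tree = tree P ; phylogenetic = phylogenetic P ; leafSet = leafSet P
    ; explains = explains P ; profile = λ _ → refl
    }

  -- How X_T(x,y) looks in a parent of the planted tree holding y: it is explained
  -- both when x lies in the same planted tree and when x is an outsider whose
  -- relation to y is the one predicted by the profile.
  seenFrom : ∀ {S f} (P : Planted S f) {x y} → y ∈ S → x ∈ S ⊎ (x ∉ S × X x y ≡ f y) →
             (if contains (tree P) x then fitchRel (tree P) x y else label P ∨ oneOnPath (tree P) y) ≡ X x y
  seenFrom P y∈S (inj₁ x∈S) rewrite holds P x∈S = explains P x∈S y∈S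
  seenFrom P y∈S (inj₂ (x∉S , cross)) rewrite lacks P x∉S = trans (profile P y∈S) (sym cross)

  join : ∀ {S₁ S₂ f} → Planted S₁ f → Planted S₂ f → Disjoint S₁ S₂ →
         (∀ {x y} → x ∈ S₂ → y ∈ S₁ → X x y ≡ f y) →
         (∀ {x y} → x ∈ S₁ → y ∈ S₂ → X x y ≡ f y) →
         Planted (S₁ ++ S₂) f
  join {S₁} {S₂} {f} P₁ P₂ disjoint cross₂₁ cross₁₂ = record
    { label = false ; tree = T ; phylogenetic = s≤s (s≤s z≤n) , phylogenetic P₁ , phylogenetic P₂ , tt
    ; leafSet = ++⁺ (leafSet P₁) (↭-trans (++-identityʳ _) (leafSet P₂))
    ; explains = explainsT ; profile = profileT
    }
    where
    T = fork (label P₁) (tree P₁) (label P₂) (tree P₂)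
    open Fork (label P₁) (tree P₁) (label P₂) (tree P₂)

    notIn₁ : ∀ {y} → y ∈ S₂ → contains (tree P₁) y ≡ false
    notIn₁ y∈S₂ = lacks P₁ (λ y∈S₁ → disjoint (y∈S₁ , y∈S₂))

    explainsT : ∀ {x y} → x ∈ S₁ ++ S₂ → y ∈ S₁ ++ S₂ → fitchRel T x y ≡ X x y
    explainsT {x} {y} x∈ y∈ with ∈-++⁻ S₁ x∈ | ∈-++⁻ S₁ y∈
    ... | inj₁ x∈S₁ | inj₁ y∈S₁ =
      trans (fork-relˡ x (holds P₁ y∈S₁)) (seenFrom P₁ y∈S₁ (inj₁ x∈S₁))
    ... | inj₂ x∈S₂ | inj₁ y∈S₁ =
      trans (fork-relˡ x (holds P₁ y∈S₁))
            (seenFrom P₁ y∈S₁ (inj₂ ((λ x∈S₁ → disjoint (x∈S₁ , x∈S₂)) , cross₂₁ x∈S₂ y∈S₁)))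
    ... | inj₁ x∈S₁ | inj₂ y∈S₂ =
      trans (fork-relʳ x (notIn₁ y∈S₂) (holds P₂ y∈S₂))
            (seenFrom P₂ y∈S₂ (inj₂ ((λ x∈S₂ → disjoint (x∈S₁ , x∈S₂)) , cross₁₂ x∈S₁ y∈S₂)))
    ... | inj₂ x∈S₂ | inj₂ y∈S₂ =
      trans (fork-relʳ x (notIn₁ y∈S₂) (holds P₂ y∈S₂)) (seenFrom P₂ y∈S₂ (inj₁ x∈S₂))

    profileT : ∀ {y} → y ∈ S₁ ++ S₂ → oneOnPath T y ≡ f y
    profileT y∈ with ∈-++⁻ S₁ y∈
    ... | inj₁ y∈S₁ = trans (fork-pathˡ (holds P₁ y∈S₁)) (profile P₁ y∈S₁)
    ... | inj₂ y∈S₂ =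
      trans (fork-pathʳ (notIn₁ y∈S₂) (holds P₂ y∈S₂)) (profile P₂ y∈S₂)

  module Construction (axioms : FitchAxioms X) where

    open FitchAxioms axioms

    below? : ∀ m → Decidable (λ x → X x m ≡ false)
    below? m x = X x m ≟ᵇ false

    sameRow : ∀ {m e} → X m e ≡ false → X e m ≡ false → ∀ y → X e y ≡ X m y
    sameRow {m} {e} m⊑e e⊑m y with X m y in m→y | X e y in e→y
    ... | false | false = refl
    ... | true  | true  = refl
    ... | false | true  = trans (sym e→y) (zeroTransitive e⊑m m→y)
    ... | true  | false = sym (trans (sym m→y) (zeroTransitive m⊑e e→y))

    -- The fuel k bounds the sizes of the sets involved; it strictly decreases along
    -- every cycle of calls.
    mutual
      cluster : ∀ k m {D} → length D < k → m ∉ D → Unique D → (∀ {x} → x ∈ D → X x m ≡ false) →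
                Planted (m ∷ D) (X m)
      cluster _ m {[]} _ _ _ _ = sprout m
      cluster (suc k) m {D@(_ ∷ _)} (s≤s size) m∉D uniqueD belowD =
        join (sprout m) (beneath k m size uniqueD belowD)
             (λ { (here refl , m∈D) → m∉D m∈D }) cross (λ { (here refl) _ → refl })
        where
        cross : ∀ {x y} → x ∈ D → y ∈ [ m ] → X x y ≡ X m y
        cross x∈D (here refl) = trans (belowD x∈D) (sym (irreflexive m))

      -- The elements below m other than m, with profile X m: if one of them, e, is
      -- also above m, it is the down-set of e; otherwise X m is constantly 1 there.
      beneath : ∀ k m {d ds} → length (d ∷ ds) ≤ k → Unique (d ∷ ds) →
                (∀ {x} → x ∈ d ∷ ds → X x m ≡ false) → Planted (d ∷ ds) (X m)
      beneath k m {d} {ds} size uniqueD belowD with any? (λ e → X m e ≟ᵇ false) (d ∷ ds)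
      ... | yes twin with find twin
      ...   | e , e∈D , m⊑e with extract e∈D
      ...     | D' , p with unique-resp-↭ p uniqueD
      ...       | uniqueED'@(_ ∷ uniqueD') =
        reorder (relabel (cluster k e sizeD' (Unique[x∷xs]⇒x∉xs uniqueED') uniqueD' belowE)
                         (λ {y} _ → sameRow m⊑e (belowD e∈D) y))
                (↭-sym p)
        where
        sizeD' : length D' < k
        sizeD' = ≤-trans (≤-reflexive (sym (↭-length p))) size
        belowE : ∀ {x} → x ∈ D' → X x e ≡ false
        belowE x∈D' = zeroTransitive (belowD (∈-resp-↭ (↭-sym p) (there x∈D'))) m⊑e
      beneath k m size uniqueD belowD | no noTwin =
        relabel (top k size uniqueD) (λ y∈D → sym (¬-not (λ m⊑y → noTwin (lose y∈D m⊑y))))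

      top : ∀ k {s ss} → length ss < k → Unique (s ∷ ss) → Planted (s ∷ ss) (λ _ → true)
      top k {s} {ss} size uniqueS with maximal zeroTransitive (λ x y → X x y ≟ᵇ false) s ss
      ... | m , m∈S , mMax with extract m∈S
      ...   | S' , p with unique-resp-↭ p uniqueS
      ...     | uniqueMS'@(_ ∷ uniqueS') =
        reorder (assemble k m sizeS' (Unique[x∷xs]⇒x∉xs uniqueMS') uniqueS'
                          (λ z∈S' → mMax (∈-resp-↭ (↭-sym p) (there z∈S'))))
                (↭-sym p)
        where
        sizeS' : length S' < k
        sizeS' = ≤-trans (≤-reflexive (sym (↭-length p))) size

      assemble : ∀ k m {S'} → length S' < k → m ∉ S' → Unique S' →
                 (∀ {z} → z ∈ S' → X m z ≡ false → X z m ≡ false) → Planted (m ∷ S') (λ _ → true)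
      assemble k m {S'} size m∉S' uniqueS' mMax =
        reorder (withRest k m (≤-<-trans (length-filter (∁? (below? m)) S') size) (filter⁺ _ uniqueS')
                          downSet belowK notBelowR (λ z∈R → mMax (inS' (∁? (below? m)) z∈R)))
                (↭-prep m (↭-sym (split (below? m) S')))
        where
        K = filter (below? m) S'
        R = filter (∁? (below? m)) S'

        inS' : ∀ {p} {P : Pred (Fin N) p} (P? : Decidable P) {z} → z ∈ filter P? S' → z ∈ S'
        inS' P? z∈ = proj₁ (∈-filter⁻ P? {xs = S'} z∈)

        belowK : ∀ {x} → x ∈ m ∷ K → X x m ≡ false
        belowK (here refl) = irreflexive m
        belowK (there x∈K) = proj₂ (∈-filter⁻ (below? m) {xs = S'} x∈K)

        notBelowR : ∀ {x} → x ∈ R → X x m ≢ false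
        notBelowR x∈R = proj₂ (∈-filter⁻ (∁? (below? m)) {xs = S'} x∈R)

        downSet : Planted (m ∷ K) (λ _ → true)
        downSet = raise (cluster k m (≤-<-trans (length-filter (below? m) S') size)
                                 (λ m∈K → m∉S' (inS' (below? m) m∈K)) (filter⁺ _ uniqueS') (λ x∈K → belowK (there x∈K)))

      -- m's down-set joined with the rest R, when R is nonempty; every pair across
      -- is X-related in both directions.
      withRest : ∀ k m {K R} → length R < k → Unique R → Planted (m ∷ K) (λ _ → true) →
                 (∀ {x} → x ∈ m ∷ K → X x m ≡ false) → (∀ {x} → x ∈ R → X x m ≢ false) →
                 (∀ {z} → z ∈ R → X m z ≡ false → X z m ≡ false) → Planted (m ∷ K ++ R) (λ _ → true)
      withRest k m {K} {[]} _ _ downSet _ _ _ = reorder downSet (↭-sym (++-identityʳ (m ∷ K)))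
      withRest (suc k) m {K} {R@(_ ∷ _)} (s≤s size) uniqueR downSet belowK notBelowR mMax =
        join downSet (top k size uniqueR) (λ (x∈ , x∈R) → notBelowR x∈R (belowK x∈)) cross₂₁ cross₁₂
        where
        cross₂₁ : ∀ {x y} → x ∈ R → y ∈ m ∷ K → X x y ≡ true
        cross₂₁ x∈R y∈ = ¬-not (λ x⊑y → notBelowR x∈R (zeroTransitive x⊑y (belowK y∈)))

        cross₁₂ : ∀ {x y} → x ∈ m ∷ K → y ∈ R → X x y ≡ true
        cross₁₂ x∈ y∈R = ¬-not λ x⊑y → case zeroComparable (belowK x∈) x⊑y of λ where
          (inj₁ m⊑y) → notBelowR y∈R (mMax y∈R m⊑y)
          (inj₂ y⊑m) → notBelowR y∈R y⊑m

axioms⇒valid : ∀ {n} {X : Rel₂ (suc n)} → Irreflexive X → FitchAxioms X → Valid X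
axioms⇒valid {n} {X} irreflexive axioms =
  tree P , phylogenetic P , leafSet P , λ x y _ → sym (explains P (∈-allFin x) (∈-allFin y))
  where
  open Planting X irreflexive
  open Planted
  open Construction axioms

  P : Planted (allFin (suc n)) (λ _ → true)
  P = top (length (allFin (suc n))) ≤-refl (allFin⁺ (suc n))

module _ {m n : ℕ} (X : Rel₂ n) (f : Fin m → Fin n) where

  restrict-irreflexive : Irreflexive X → Irreflexive (λ i j → X (f i) (f j))
  restrict-irreflexive irreflexive i = irreflexive (f i)

  restrict-axioms : FitchAxioms X → FitchAxioms (λ i j → X (f i) (f j))
  restrict-axioms axioms = record { zeroTransitive = zeroTransitive ; zeroComparable = zeroComparable }
    where open FitchAxioms axioms

-- The axioms are statements about three elements at a time, and for three
-- distinct elements they follow from validity of the triangle.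
fitch⇒axioms : ∀ {n} {X : Rel₂ n} → Irreflexive X → Fitch X → FitchAxioms X
fitch⇒axioms {X = X} irreflexive fitch = record { zeroTransitive = transitive ; zeroComparable = comparable }
  where
  triangle : ∀ {x y z} → x ≢ y → x ≢ z → y ≢ z → FitchAxioms (restrict3 X x y z)
  triangle {x} {y} {z} x≢y x≢z y≢z =
    valid⇒axioms (restrict-irreflexive X (triple x y z) irreflexive) (fitch x y z x≢y x≢z y≢z)

  transitive : ZeroTransitive X
  transitive {x} {y} {z} h₁ h₂ with x ≟ y | y ≟ z | x ≟ z
  ... | yes refl | _ | _ = h₂
  ... | no _ | yes refl | _ = h₁
  ... | no _ | no _ | yes refl = irreflexive x
  ... | no x≢y | no y≢z | no x≢z =
    FitchAxioms.zeroTransitive (triangle x≢y x≢z y≢z) {zero} {suc zero} {suc (suc zero)} h₁ h₂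

  comparable : ZeroComparable X
  comparable {x} {y} {z} h₁ h₂ with x ≟ y | x ≟ z | y ≟ z
  ... | yes refl | _ | _ = inj₁ h₂
  ... | no _ | yes refl | _ = inj₂ h₁
  ... | no _ | no _ | yes refl = inj₁ (irreflexive y)
  ... | no x≢y | no x≢z | no y≢z =
    FitchAxioms.zeroComparable (triangle x≢y x≢z y≢z) {zero} {suc zero} {suc (suc zero)} h₁ h₂

theorem2 : ∀ (n : ℕ) (X : Rel₂ (suc n)) → Irreflexive X → (Valid X ⇔ Fitch X)
theorem2 n X irreflexive = mk⇔ valid⇒fitch fitch⇒valid
  where
  -- every triangle of a valid relation inherits the axioms and is therefore valid
  valid⇒fitch : Valid X → Fitch X
  valid⇒fitch valid a b c _ _ _ =
    axioms⇒valid (restrict-irreflexive X (triple a b c) irreflexive)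
                 (restrict-axioms X (triple a b c) (valid⇒axioms irreflexive valid))

  fitch⇒valid : Fitch X → Valid X
  fitch⇒valid fitch = axioms⇒valid irreflexive (fitch⇒axioms irreflexive fitch)
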